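{- Let $N=(S,A,T,I)$ be a finite PTI net. Then pti-place bisimilarity $\sim_p \subseteq \mathcal{M}(S)\times\mathcal{M}(S)$ is an equivalence relation on the set $\mathcal{M}(S)$ of markings of $N$.
   Context: Multisets over a finite set $S$ are functions $m:S\to\mathbb{N}$; $\mathcal{M}(S)$ is the set of all of them, $\theta$ is the empty multiset, $m\subseteq m'$ means $m(s)\le m'(s)$ for all $s$, $(m\oplus m')(s)=m(s)+m'(s)$, $(m\ominus m')(s)=\max\{m(s)-m'(s),0\}$, $\mathit{dom}(m)=\{s\mid m(s)\neq 0\}$, and a place $s$ also denotes the multiset containing only $s$ once. A finite PTI net is $N=(S,A,T,I)$ with $S$ a finite set of places, $A$ a finite set of labels, $T\subseteq(\mathcal{M}(S)\setminus\{\theta\})\times A\times(\mathcal{M}(S)\setminus\{\theta\})$ a finite set of transitions, and $I\subseteq S\times T$ the inhibiting relation. For $t=(m,\ell,m')$ write ${}^\bullet t=m$ (pre-set), $l(t)=\ell$, $t^\bullet=m'$ (post-set), and ${}^\circ t=\{s\in S\mid (s,t)\in I\}$ (inhibiting set). A transition $t$ is enabled at marking $m$, written $m[t\rangle$, if ${}^\bullet t\subseteq m$ and ${}^\circ t\cap\mathit{dom}(m)=\emptyset$; firing gives $m[t\rangle m'$ with $m'=(m\ominus {}^\bullet t)\oplus t^\bullet$. For a place relation $R\subseteq S\times S$, its additive closure $R^\oplus\subseteq\mathcal{M}(S)\times\mathcal{M}(S)$ is the least relation such that $(\theta,\theta)\in R^\oplus$, and if $(s_1,s_2)\in R$ and $(m_1,m_2)\in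 R^\oplus$ then $(s_1\oplus m_1,s_2\oplus m_2)\in R^\oplus$ (equivalently, $m_1=s_1\oplus\dots\oplus s_k$, $m_2=s_1'\oplus\dots\oplus s_k'$ with $(s_i,s_i')\in R$ for all $i$). A pti-place bisimulation is a relation $R\subseteq S\times S$ such that whenever $(m_1,m_2)\in R^\oplus$: (1) for every $t_1$ with $m_1[t_1\rangle m_1'$ there is $t_2$ with $m_2[t_2\rangle m_2'$ such that (a) $({}^\bullet t_1,{}^\bullet t_2)\in R^\oplus$, $(t_1^\bullet,t_2^\bullet)\in R^\oplus$, $l(t_1)=l(t_2)$ and $(m_1\ominus{}^\bullet t_1, m_2\ominus{}^\bullet t_2)\in R^\oplus$, and (b) for all $s,s'\in S$ with $(s,s')\in R$: $s\in{}^\circ t_1\iff s'\in{}^\circ t_2$; (2) symmetrically, for every $t_2$ with $m_2[t_2\rangle m_2'$ there is $t_1$ with $m_1[t_1\rangle m_1'$ satisfying (a) and (b). Two markings are pti-place bisimilar, $m_1\sim_p m_2$, if there is a pti-place bisimulation $R$ with $(m_1,m_2)\in R^\oplus$. -}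

module Defs where

open import Level using (0ℓ)
open import Data.Nat using (ℕ; zero; suc; _+_; _∸_; _≤_)
open import Data.Fin using (Fin; _≟_)
open import Data.Fin.Subset using (Subset; _∈_)
open import Data.Product using (Σ; Σ-syntax; ∃; ∃-syntax; _×_; _,_)
open import Relation.Nullary using (¬_; yes; no)
open import Relation.Binary using (Rel)
open import Relation.Binary.PropositionalEquality using (_≡_; _≢_)
open import Function.Bundles using (_⇔_)

Multiset : ℕ → Set
Multiset n = Fin n → ℕ

module _ {n : ℕ} where

  θ : Multiset n
  θ _ = 0

  ⟦_⟧ : Fin n → Multiset n
  ⟦ s ⟧ s' with s ≟ s'
  ... | yes _ = 1
  ... | no _  = 0

  _⊕_ : Multiset n → Multiset n → Multiset n
  (m ⊕ m') s = m s + m' s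

  _⊖_ : Multiset n → Multiset n → Multiset n
  (m ⊖ m') s = m s ∸ m' s

  _⊆ₘ_ : Multiset n → Multiset n → Set
  m ⊆ₘ m' = ∀ s → m s ≤ m' s

  _≐_ : Multiset n → Multiset n → Set
  m ≐ m' = ∀ s → m s ≡ m' s

  InDom : Fin n → Multiset n → Set
  InDom s m = m s ≢ 0

  NonEmpty : Multiset n → Set
  NonEmpty m = ¬ (m ≐ θ)

-- Transition t is the triple (pre t , label t , post t); distinct indices are
-- distinct triples (T is a set of triples); inhib t is the inhibiting set °t,
-- i.e. I = {(s,t) | s ∈ inhib t}.
record PTINet : Set where
  field
    nS nA nT : ℕ
    pre  : Fin nT → Multiset nS
    label : Fin nT → Fin nA
    post : Fin nT → Multiset nS
    pre-nonempty  : ∀ t → NonEmpty (pre t)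
    post-nonempty : ∀ t → NonEmpty (post t)
    triples-distinct : ∀ t t' → pre t ≐ pre t' → label t ≡ label t' → post t ≐ post t' → t ≡ t'
    inhib : Fin nT → Subset nS

module _ (N : PTINet) where
  open PTINet N

  Marking : Set
  Marking = Multiset nS

  Place : Set
  Place = Fin nS

  Transition : Set
  Transition = Fin nT

  Enabled : Marking → Transition → Set
  Enabled m t = (pre t ⊆ₘ m) × (∀ s → s ∈ inhib t → ¬ InDom s m)

  data AddClosure (R : Rel Place 0ℓ) : Marking → Marking → Set where
    θ-rel : ∀ {m₁ m₂} → m₁ ≐ θ → m₂ ≐ θ → AddClosure R m₁ m₂
    ⊕-rel : ∀ {s₁ s₂ m₁ m₂ m₁' m₂'} → R s₁ s₂ → AddClosure R m₁ m₂ →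
            m₁' ≐ (⟦ s₁ ⟧ ⊕ m₁) → m₂' ≐ (⟦ s₂ ⟧ ⊕ m₂) → AddClosure R m₁' m₂'

  Matches : Rel Place 0ℓ → Marking → Marking → Transition → Transition → Set
  Matches R m₁ m₂ t₁ t₂ =
    AddClosure R (pre t₁) (pre t₂) ×
    AddClosure R (post t₁) (post t₂) ×
    label t₁ ≡ label t₂ ×
    AddClosure R (m₁ ⊖ pre t₁) (m₂ ⊖ pre t₂) ×
    (∀ s s' → R s s' → (s ∈ inhib t₁) ⇔ (s' ∈ inhib t₂))

  IsPtiPlaceBisimulation : Rel Place 0ℓ → Set
  IsPtiPlaceBisimulation R = ∀ m₁ m₂ → AddClosure R m₁ m₂ →
    (∀ t₁ → Enabled m₁ t₁ → Σ[ t₂ ∈ Transition ] (Enabled m₂ t₂ × Matches R m₁ m₂ t₁ t₂)) ×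
    (∀ t₂ → Enabled m₂ t₂ → Σ[ t₁ ∈ Transition ] (Enabled m₁ t₁ × Matches R m₁ m₂ t₁ t₂))

  PtiPlaceBisimilar : Marking → Marking → Set₁
  PtiPlaceBisimilar m₁ m₂ =
    Σ[ R ∈ Rel Place 0ℓ ] (IsPtiPlaceBisimulation R × AddClosure R m₁ m₂)

-- Reflexivity, symmetry and transitivity of ∼p are witnessed by the identity
-- relation, the converse R⁻¹ and the composite R₁ ; R₂ of the witnessing place
-- relations.  The bisimulation conditions transfer along these operations once
-- one knows that additive closure commutes with them; the only non-trivial part
-- is R₁^⊕ ; R₂^⊕ ⊆ (R₁ ; R₂)^⊕, which rests on the fact that a place occurring on
-- one side of an R^⊕-related pair can be cancelled against an R-partner on the
-- other side, leaving an R^⊕-related pair.  Reflexivity of R^⊕ uses that every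
-- multiset is a finite sum of places.

module Submission where

open import Defs
open import Level using (0ℓ)
open import Data.Nat using (ℕ; suc; _+_; _∸_; _≤_; z≤n)
open import Data.Nat.Properties using (+-cancelˡ-≡; +-identityʳ; m≤m+n; m+[n∸m]≡n; +-commutativeSemigroup)
open import Algebra.Properties.CommutativeSemigroup +-commutativeSemigroup using (x∙yz≈y∙xz)
open import Data.Fin using (Fin; zero; suc)
open import Data.Fin.Properties using (_≟_; suc-injective)
open import Data.List using (List; []; _∷_; _++_; map; replicate)
open import Data.List.Relation.Binary.Pointwise using (Pointwise; []; _∷_)
import Data.List.Relation.Binary.Pointwise as Pointwise
open import Data.Product using (∃; ∃₂; _×_; _,_)
open import Data.Empty using (⊥-elim)
open import Function using (_∘_; flip)
open import Function.Construct.Identity using (⇔-id)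
open import Function.Construct.Symmetry using (⇔-sym)
open import Function.Construct.Composition using (_⇔-∘_)
open import Relation.Nullary using (¬_; Dec; yes; no)
open import Relation.Binary using (Rel; Reflexive; Setoid)
open import Relation.Binary.Construct.Composition using (_;_)
open import Relation.Binary.Structures using (IsEquivalence)
open import Relation.Binary.PropositionalEquality
  using (_≡_; _≢_; refl; sym; trans; cong; cong₂; subst; _→-setoid_; module ≡-Reasoning)

module _ {n : ℕ} where

  ⟦⟧-self : (s : Fin n) → ⟦ s ⟧ s ≡ 1
  ⟦⟧-self s with s ≟ s
  ... | yes _  = refl
  ... | no s≢s = ⊥-elim (s≢s refl)

  ⟦⟧-other : {s x : Fin n} → s ≢ x → ⟦ s ⟧ x ≡ 0
  ⟦⟧-other {s} {x} s≢x with s ≟ x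
  ... | yes s≡x = ⊥-elim (s≢x s≡x)
  ... | no _    = refl

  ⟦⟧⊆ₘ : {s : Fin n} {m : Multiset n} → 1 ≤ m s → ⟦ s ⟧ ⊆ₘ m
  ⟦⟧⊆ₘ {s} {m} 1≤ms x with s ≟ x
  ... | yes refl = 1≤ms
  ... | no _     = z≤n

  ⟦⟧⊕≢θ : (s : Fin n) (m : Multiset n) → ¬ ((⟦ s ⟧ ⊕ m) ≐ θ)
  ⟦⟧⊕≢θ s m eq with trans (sym (cong (_+ m s) (⟦⟧-self s))) (eq s)
  ... | ()

  ⊕-cancelˡ : (a : Multiset n) {m m' : Multiset n} → (a ⊕ m) ≐ (a ⊕ m') → m ≐ m'
  ⊕-cancelˡ a eq x = +-cancelˡ-≡ (a x) _ _ (eq x)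

  ⊕-swapˡ : (a b m : Multiset n) → (a ⊕ (b ⊕ m)) ≐ (b ⊕ (a ⊕ m))
  ⊕-swapˡ a b m x = x∙yz≈y∙xz (a x) (b x) (m x)

  ⊆ₘ⇒⊕⊖ : {a m : Multiset n} → a ⊆ₘ m → m ≐ (a ⊕ (m ⊖ a))
  ⊆ₘ⇒⊕⊖ a⊆m x = sym (m+[n∸m]≡n (a⊆m x))

  ⟦⟧⊕-exchange : {b s : Fin n} {m₁ m₂ : Multiset n} → b ≢ s → (⟦ s ⟧ ⊕ m₁) ≐ (⟦ b ⟧ ⊕ m₂) →
                 m₂ ≐ (⟦ s ⟧ ⊕ (m₂ ⊖ ⟦ s ⟧)) × m₁ ≐ (⟦ b ⟧ ⊕ (m₂ ⊖ ⟦ s ⟧))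
  ⟦⟧⊕-exchange {b} {s} {m₁} {m₂} b≢s eq = m₂-split , ⊕-cancelˡ ⟦ s ⟧ m₁-split
    where
    1≤m₂s : 1 ≤ m₂ s
    1≤m₂s = subst (1 ≤_) (trans (cong (_+ m₁ s) (sym (⟦⟧-self s)))
                                (trans (eq s) (cong (_+ m₂ s) (⟦⟧-other b≢s))))
                         (m≤m+n 1 (m₁ s))
    m₂-split : m₂ ≐ (⟦ s ⟧ ⊕ (m₂ ⊖ ⟦ s ⟧))
    m₂-split = ⊆ₘ⇒⊕⊖ (⟦⟧⊆ₘ 1≤m₂s)
    m₁-split : (⟦ s ⟧ ⊕ m₁) ≐ (⟦ s ⟧ ⊕ (⟦ b ⟧ ⊕ (m₂ ⊖ ⟦ s ⟧)))
    m₁-split x = trans (eq x) (trans (cong (⟦ b ⟧ x +_) (m₂-split x))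
                                     (⊕-swapˡ ⟦ b ⟧ ⟦ s ⟧ (m₂ ⊖ ⟦ s ⟧) x))

  ∑ : List (Fin n) → Multiset n
  ∑ []      = θ
  ∑ (s ∷ L) = ⟦ s ⟧ ⊕ ∑ L

⟦suc⟧ : ∀ {n} (s x : Fin n) → ⟦ suc s ⟧ (suc x) ≡ ⟦ s ⟧ x
⟦suc⟧ s x = by-cases (s ≟ x)
  where
  by-cases : Dec (s ≡ x) → ⟦ suc s ⟧ (suc x) ≡ ⟦ s ⟧ x
  by-cases (yes refl) = trans (⟦⟧-self (suc s)) (sym (⟦⟧-self s))
  by-cases (no s≢x)   = trans (⟦⟧-other (s≢x ∘ suc-injective)) (sym (⟦⟧-other s≢x))

∑-map-suc-zero : ∀ {n} (L : List (Fin n)) → ∑ (map suc L) zero ≡ 0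
∑-map-suc-zero []      = refl
∑-map-suc-zero (s ∷ L) = ∑-map-suc-zero L

∑-map-suc-suc : ∀ {n} (L : List (Fin n)) (x : Fin n) → ∑ (map suc L) (suc x) ≡ ∑ L x
∑-map-suc-suc []      x = refl
∑-map-suc-suc (s ∷ L) x = cong₂ _+_ (⟦suc⟧ s x) (∑-map-suc-suc L x)

∑-replicate-zero-at-zero : ∀ {n} (k : ℕ) (L : List (Fin (suc n))) →
                           ∑ (replicate k zero ++ L) zero ≡ k + ∑ L zero
∑-replicate-zero-at-zero 0       L = refl
∑-replicate-zero-at-zero (suc k) L = cong suc (∑-replicate-zero-at-zero k L)

∑-replicate-zero-at-suc : ∀ {n} (k : ℕ) (L : List (Fin (suc n))) (x : Fin n) →
                          ∑ (replicate k zero ++ L) (suc x) ≡ ∑ L (suc x)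
∑-replicate-zero-at-suc 0       L x = refl
∑-replicate-zero-at-suc (suc k) L x = ∑-replicate-zero-at-suc k L x

multiset≐∑ : ∀ {n} (m : Multiset n) → ∃ λ L → m ≐ ∑ L
multiset≐∑ {0}     m = [] , λ ()
multiset≐∑ {suc n} m with multiset≐∑ (m ∘ suc)
... | L , m∘suc≐∑L = replicate (m zero) zero ++ map suc L , m≐∑
  where
  open ≡-Reasoning
  m≐∑ : m ≐ ∑ (replicate (m zero) zero ++ map suc L)
  m≐∑ zero = begin
    m zero                                          ≡⟨ +-identityʳ (m zero) ⟨
    m zero + 0                                      ≡⟨ cong (m zero +_) (∑-map-suc-zero L) ⟨
    m zero + ∑ (map suc L) zero                     ≡⟨ ∑-replicate-zero-at-zero (m zero) (map suc L) ⟨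
    ∑ (replicate (m zero) zero ++ map suc L) zero   ∎
  m≐∑ (suc x) = begin
    m (suc x)                                       ≡⟨ m∘suc≐∑L x ⟩
    ∑ L x                                           ≡⟨ ∑-map-suc-suc L x ⟨
    ∑ (map suc L) (suc x)                           ≡⟨ ∑-replicate-zero-at-suc (m zero) (map suc L) x ⟨
    ∑ (replicate (m zero) zero ++ map suc L) (suc x) ∎

module _ (N : PTINet) where
  open PTINet N

  private
    module ≐ = Setoid (Place N →-setoid ℕ)

    variable
      R R₁ R₂ : Rel (Place N) 0ℓ
      a b c : Marking N

  AddClosure-resp-≐ : AddClosure N R a b → ∀ {a' b'} → a ≐ a' → b ≐ b' → AddClosure N R a' b'
  AddClosure-resp-≐ (θ-rel a≐θ b≐θ)   a≐a' b≐b' = θ-rel (≐.trans (≐.sym a≐a') a≐θ) (≐.trans (≐.sym b≐b') b≐θ)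
  AddClosure-resp-≐ (⊕-rel r ab a≐ b≐) a≐a' b≐b' = ⊕-rel r ab (≐.trans (≐.sym a≐a') a≐) (≐.trans (≐.sym b≐b') b≐)

  AddClosure-∑ : ∀ {L₁ L₂} → Pointwise R L₁ L₂ → AddClosure N R (∑ L₁) (∑ L₂)
  AddClosure-∑ []       = θ-rel ≐.refl ≐.refl
  AddClosure-∑ (r ∷ rs) = ⊕-rel r (AddClosure-∑ rs) ≐.refl ≐.refl

  AddClosure-refl : Reflexive R → ∀ m → AddClosure N R m m
  AddClosure-refl rfl m with multiset≐∑ m
  ... | L , m≐∑L = AddClosure-resp-≐ (AddClosure-∑ (Pointwise.refl rfl {L})) (≐.sym m≐∑L) (≐.sym m≐∑L)

  AddClosure-≡⇒≐ : AddClosure N _≡_ a b → a ≐ b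
  AddClosure-≡⇒≐ (θ-rel a≐θ b≐θ)         = ≐.trans a≐θ (≐.sym b≐θ)
  AddClosure-≡⇒≐ (⊕-rel refl ab a≐ b≐) x = trans (a≐ x) (trans (cong (_ +_) (AddClosure-≡⇒≐ ab x)) (sym (b≐ x)))

  AddClosure-flip : AddClosure N R a b → AddClosure N (flip R) b a
  AddClosure-flip (θ-rel a≐θ b≐θ)   = θ-rel b≐θ a≐θ
  AddClosure-flip (⊕-rel r ab a≐ b≐) = ⊕-rel r (AddClosure-flip ab) b≐ a≐

  AddClosure-θʳ : AddClosure N R a b → b ≐ θ → a ≐ θ
  AddClosure-θʳ (θ-rel a≐θ _)               _   = a≐θ
  AddClosure-θʳ (⊕-rel {s₂ = s₂} _ _ _ b≐) b≐θ = ⊥-elim (⟦⟧⊕≢θ s₂ _ (≐.trans (≐.sym b≐) b≐θ))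

  AddClosure-removeʳ : AddClosure N R a b → ∀ {s b'} → b ≐ (⟦ s ⟧ ⊕ b') →
                       ∃₂ λ s₁ a' → R s₁ s × a ≐ (⟦ s₁ ⟧ ⊕ a') × AddClosure N R a' b'
  AddClosure-removeʳ (θ-rel _ b≐θ) {s} {b'} b≐ = ⊥-elim (⟦⟧⊕≢θ s b' (≐.trans (≐.sym b≐) b≐θ))
  AddClosure-removeʳ {a = a} (⊕-rel {s₁ = u} {s₂ = v} {m₁ = c₁} {m₂ = c₂} r cs a≐ b≐) {s} {b'} b≐' with v ≟ s
  ... | yes refl = u , c₁ , r , a≐ , AddClosure-resp-≐ cs ≐.refl (⊕-cancelˡ ⟦ v ⟧ (≐.trans (≐.sym b≐) b≐'))
  ... | no v≢s with ⟦⟧⊕-exchange v≢s (≐.trans (≐.sym b≐') b≐)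
  ...   | c₂≐ , b'≐ with AddClosure-removeʳ cs c₂≐
  ...     | s₁ , c₁' , r₁ , c₁≐ , cs' = s₁ , ⟦ u ⟧ ⊕ c₁' , r₁ , a≐′ , ⊕-rel r cs' ≐.refl b'≐
    where
    a≐′ : a ≐ (⟦ s₁ ⟧ ⊕ (⟦ u ⟧ ⊕ c₁'))
    a≐′ x = trans (a≐ x) (trans (cong (⟦ u ⟧ x +_) (c₁≐ x)) (⊕-swapˡ ⟦ u ⟧ ⟦ s₁ ⟧ c₁' x))

  AddClosure-∘ : AddClosure N R₁ a b → AddClosure N R₂ b c → AddClosure N (R₁ ; R₂) a c
  AddClosure-∘ ab (θ-rel b≐θ c≐θ) = θ-rel (AddClosure-θʳ ab b≐θ) c≐θ
  AddClosure-∘ ab (⊕-rel {s₁ = v} r₂ bc b≐ c≐) with AddClosure-removeʳ ab b≐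
  ... | u , a' , r₁ , a≐ , ab' = ⊕-rel (v , r₁ , r₂) (AddClosure-∘ ab' bc) a≐ c≐

  AddClosure-split : AddClosure N (R₁ ; R₂) a c → ∃ λ b → AddClosure N R₁ a b × AddClosure N R₂ b c
  AddClosure-split (θ-rel a≐θ c≐θ) = θ , θ-rel a≐θ ≐.refl , θ-rel ≐.refl c≐θ
  AddClosure-split (⊕-rel (v , r₁ , r₂) ac a≐ c≐) with AddClosure-split ac
  ... | b , ab , bc = ⟦ v ⟧ ⊕ b , ⊕-rel r₁ ab a≐ ≐.refl , ⊕-rel r₂ bc ≐.refl c≐

  Enabled-resp-≐ : ∀ {t} → Enabled N a t → a ≐ b → Enabled N b t
  Enabled-resp-≐ {t = t} (pre⊆a , a-uninhibited) a≐b =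
    (λ x → subst (pre t x ≤_) (a≐b x) (pre⊆a x)) ,
    (λ s s∈°t b-marks-s → a-uninhibited s s∈°t (b-marks-s ∘ trans (sym (a≐b s))))

  ≡-isPtiPlaceBisimulation : IsPtiPlaceBisimulation N _≡_
  ≡-isPtiPlaceBisimulation m₁ m₂ m₁m₂ =
    (λ t m₁[t⟩ → t , Enabled-resp-≐ m₁[t⟩ m₁≐m₂ , matches-self t) ,
    (λ t m₂[t⟩ → t , Enabled-resp-≐ m₂[t⟩ (≐.sym m₁≐m₂) , matches-self t)
    where
    m₁≐m₂ : m₁ ≐ m₂
    m₁≐m₂ = AddClosure-≡⇒≐ m₁m₂
    matches-self : ∀ t → Matches N _≡_ m₁ m₂ t t
    matches-self t =
      AddClosure-refl refl (pre t) , AddClosure-refl refl (post t) , refl ,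
      AddClosure-resp-≐ (AddClosure-refl refl (m₁ ⊖ pre t)) ≐.refl (λ x → cong (_∸ pre t x) (m₁≐m₂ x)) ,
      λ { s .s refl → ⇔-id _ }

  Matches-flip : ∀ {m₁ m₂ t₁ t₂} → Matches N R m₁ m₂ t₁ t₂ → Matches N (flip R) m₂ m₁ t₂ t₁
  Matches-flip (pres , posts , labels , rests , inhibs) =
    AddClosure-flip pres , AddClosure-flip posts , sym labels , AddClosure-flip rests ,
    λ s s' r → ⇔-sym (inhibs s' s r)

  flip-isPtiPlaceBisimulation : IsPtiPlaceBisimulation N R → IsPtiPlaceBisimulation N (flip R)
  flip-isPtiPlaceBisimulation {R} bisim m₁ m₂ m₁m₂ with bisim m₂ m₁ (AddClosure-flip {R = flip R} m₁m₂)
  ... | forth , back =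
    (λ t m₁[t⟩ → let t' , m₂[t'⟩ , match = back t m₁[t⟩ in t' , m₂[t'⟩ , Matches-flip match) ,
    (λ t m₂[t⟩ → let t' , m₁[t'⟩ , match = forth t m₂[t⟩ in t' , m₁[t'⟩ , Matches-flip match)

  Matches-∘ : ∀ {m₁ m₂ m₃ t₁ t₂ t₃} → Matches N R₁ m₁ m₂ t₁ t₂ → Matches N R₂ m₂ m₃ t₂ t₃ →
              Matches N (R₁ ; R₂) m₁ m₃ t₁ t₃
  Matches-∘ (pres , posts , labels , rests , inhibs) (pres' , posts' , labels' , rests' , inhibs') =
    AddClosure-∘ pres pres' , AddClosure-∘ posts posts' , trans labels labels' , AddClosure-∘ rests rests' ,
    λ { s s'' (s' , r₁ , r₂) → inhibs' s' s'' r₂ ⇔-∘ inhibs s s' r₁ }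

  ;-isPtiPlaceBisimulation : IsPtiPlaceBisimulation N R₁ → IsPtiPlaceBisimulation N R₂ →
                             IsPtiPlaceBisimulation N (R₁ ; R₂)
  ;-isPtiPlaceBisimulation bisim₁ bisim₂ m₁ m₃ m₁m₃ with AddClosure-split m₁m₃
  ... | m₂ , m₁m₂ , m₂m₃ with bisim₁ m₁ m₂ m₁m₂ | bisim₂ m₂ m₃ m₂m₃
  ...   | forth₁ , back₁ | forth₂ , back₂ =
    (λ t₁ m₁[t₁⟩ → let t₂ , m₂[t₂⟩ , match₁ = forth₁ t₁ m₁[t₁⟩
                       t₃ , m₃[t₃⟩ , match₂ = forth₂ t₂ m₂[t₂⟩
                   in t₃ , m₃[t₃⟩ , Matches-∘ match₁ match₂) ,
    (λ t₃ m₃[t₃⟩ → let t₂ , m₂[t₂⟩ , match₂ = back₂ t₃ m₃[t₃⟩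
                       t₁ , m₁[t₁⟩ , match₁ = back₁ t₂ m₂[t₂⟩
                   in t₁ , m₁[t₁⟩ , Matches-∘ match₁ match₂)

proposition25 : (N : PTINet) → IsEquivalence {A = Marking N} (PtiPlaceBisimilar N)
proposition25 N = record
  { refl  = λ {m} → _≡_ , ≡-isPtiPlaceBisimulation N , AddClosure-refl N refl m
  ; sym   = λ (R , bisim , m₁m₂) → flip R , flip-isPtiPlaceBisimulation N bisim , AddClosure-flip N m₁m₂
  ; trans = λ (R₁ , bisim₁ , m₁m₂) (R₂ , bisim₂ , m₂m₃) →
      R₁ ; R₂ , ;-isPtiPlaceBisimulation N bisim₁ bisim₂ , AddClosure-∘ N m₁m₂ m₂m₃
  }
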